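{- Let $t>r\geq 2$ be integers. For any set $W$ of $t$ elements, if $\mathcal{E}\subseteq 2^W$ is a minimal non-trivial $r$-cover of $W$, then \[(|\mathcal{E}|-1)\left(r-\frac{1}{m_r(K^{(r)}_t)}\right)-\sum_{A\in\mathcal{E}}|A|\leq -t.\]
   Context: For a set $W$ with $|W|\ge r$, a collection $\mathcal{E}$ of sets is an $r$-cover of $W$ if every $r$-subset $B\subseteq W$ is contained in some $A\in\mathcal{E}$; it is trivial if $|\mathcal{E}|=1$, and minimal if no proper subcollection of $\mathcal{E}$ is an $r$-cover of $W$. $K^{(r)}_t$ is the complete $r$-graph on $t$ vertices, and for an $r$-graph $F$ with at least two edges, $m_r(F)=\max_{J\subseteq F,\,v(J)>r}\frac{e(J)-1}{v(J)-r}$; in particular $m_r(K^{(r)}_t)=\frac{\binom{t}{r}-1}{t-r}$. -}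

module Defs where

open import Data.Nat as ℕ using (ℕ; zero; suc; _∸_)
open import Data.Nat.Combinatorics using (_C_)
open import Data.Integer as ℤ using (ℤ; +_)
open import Data.Rational as ℚ using (ℚ; 0ℚ; 1/_; ≢-nonZero)
open import Data.Rational.Properties using (_≟_)
open import Data.Fin.Subset using (Subset; _⊆_; ∣_∣)
open import Data.List using (List; length; map)
open import Data.Nat.ListAction using (sum)
open import Data.List.Membership.Propositional using (_∈_)
open import Data.List.Relation.Unary.Unique.Propositional using (Unique)
open import Data.Product using (Σ; _×_; ∃)
open import Relation.Nullary using (¬_; yes; no)
open import Relation.Binary.PropositionalEquality using (_≡_)

-- total division of an integer by a natural number (x / 0 := 0; only used
-- with nonzero denominators under the hypotheses of the theorem)
_/ᵗ_ : ℤ → ℕ → ℚ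
x /ᵗ zero = 0ℚ
x /ᵗ suc d = x ℚ./ suc d

-- total reciprocal on ℚ (1/0 := 0; only used on nonzero values)
inv : ℚ → ℚ
inv p with p ≟ 0ℚ
... | yes _ = 0ℚ
... | no p≢0 = 1/_ p {{≢-nonZero p≢0}}

-- m_r(K^{(r)}_t) = (binom(t,r) - 1) / (t - r)
mK : (t r : ℕ) → ℚ
mK t r = ((+ (t C r)) ℤ.- (+ 1)) /ᵗ (t ∸ r)

-- A collection of subsets of W = Fin t, as a duplicate-free list.
-- r-cover: every r-subset B of W is contained in some A ∈ E.
IsRCover : {t : ℕ} (r : ℕ) → List (Subset t) → Set
IsRCover {t} r E = (B : Subset t) → ∣ B ∣ ≡ r → Σ (Subset t) (λ A → A ∈ E × B ⊆ A)

IsMinimalRCover : {t : ℕ} (r : ℕ) → List (Subset t) → Set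
IsMinimalRCover {t} r E =
  IsRCover r E ×
  ((E' : List (Subset t)) → (∀ {A} → A ∈ E' → A ∈ E) →
     (∃ λ A → A ∈ E × ¬ (A ∈ E')) → ¬ IsRCover r E')

NonTrivial : {t : ℕ} → List (Subset t) → Set
NonTrivial E = ¬ (length E ≡ 1)

sizeSum : {t : ℕ} → List (Subset t) → ℕ
sizeSum E = sum (map ∣_∣ E)

{-# OPTIONS --safe #-}
-- Write c = C(t,r) - 1 and d = t - r, so that 1 / m_r(K_t) = d / c; multiplying
-- the claim by c > 0 turns it into (c + 1) d + |E| r c ≤ (Σ_{A ∈ E} |A|) c + |E| d.
-- Counting pairs (B, A) with B an r-subset of A ∈ E gives c + 1 ≤ Σ_{A ∈ E} C(|A|,r).
-- By minimality every A ∈ E has |A| ≥ r, and since x ↦ C(x,r) has nondecreasing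
-- increments, its chord from r to |A| is no steeper than its chord from r to t:
-- (C(|A|,r) - 1) d ≤ (|A| - r) c.
module Submission where

open import Data.Fin.Subset using (Subset; ∣_∣; ⊥; inside; outside)
open import Data.Fin.Subset.Properties using (drop-∷-⊆; ∣⊥∣≡0; ∣p∣≤n; p⊆q⇒∣p∣≤∣q∣)
open import Data.List using (List; []; _∷_; map; filter; length)
open import Data.List.Membership.Propositional using (_∈_; _∉_)
open import Data.List.Membership.Propositional.Properties using (∈-map⁺; ∈-filter⁺; ∈-filter⁻)
open import Data.List.Relation.Unary.Any using (here; there)
open import Data.List.Relation.Unary.Unique.Propositional using (Unique)
open import Data.Nat.Combinatorics using (_C_; nCn≡1; nCk+nC[k+1]≡[n+1]C[k+1])
open import Data.Nat.ListAction using (sum)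
open import Data.Product using (_,_; proj₁; proj₂)
open import Data.Vec using (_∷_; head; tail; here)
open import Function using (_∘_)
open import Relation.Binary.PropositionalEquality
open import Relation.Nullary using (yes; no; contradiction)

open import Defs

module _ where

  open import Data.Bool using (T?)
  open import Data.Nat using (ℕ; zero; suc; _+_; _*_; _∸_; _≤_; _<_; _≤?_; _≤′_; ≤′-refl; ≤′-step; z≤n; s≤s)
  open import Data.Nat.Properties
  open import Data.Nat.Tactic.RingSolver using (solve-∀)
  open import Algebra.Properties.CommutativeSemigroup +-commutativeSemigroup using (interchange; x∙yz≈y∙xz)

  ∈⇒≤sum : ∀ {X : Set} (f : X → ℕ) {x xs} → x ∈ xs → f x ≤ sum (map f xs)
  ∈⇒≤sum f (here refl) = m≤m+n _ _
  ∈⇒≤sum f {xs = y ∷ _} (there x∈xs) = ≤-trans (∈⇒≤sum f x∈xs) (m≤n+m _ (f y))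

  sum-map-mono : ∀ {X : Set} {f g : X → ℕ} (xs : List X) → (∀ {x} → x ∈ xs → f x ≤ g x) →
    sum (map f xs) ≤ sum (map g xs)
  sum-map-mono [] _ = z≤n
  sum-map-mono (x ∷ xs) f≤g = +-mono-≤ (f≤g (here refl)) (sum-map-mono xs (f≤g ∘ there))

  sum-map-affine : ∀ {X : Set} (f : X → ℕ) a b (xs : List X) →
    sum (map (λ x → f x * a + b) xs) ≡ sum (map f xs) * a + length xs * b
  sum-map-affine f a b [] = refl
  sum-map-affine f a b (x ∷ xs) =
    trans (cong (f x * a + b +_) (sum-map-affine f a b xs)) (regroup (f x) a b (sum (map f xs)) (length xs))
    where
    regroup : ∀ y a b s k → y * a + b + (s * a + k * b) ≡ (y + s) * a + (b + k * b)
    regroup = solve-∀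

  subsetCount : ∀ {n} → ℕ → List (Subset n) → ℕ
  subsetCount r E = sum (map (λ A → ∣ A ∣ C r) E)

  tails : ∀ {n} → List (Subset (suc n)) → List (Subset n)
  tails = map tail

  tailsContaining0 : ∀ {n} → List (Subset (suc n)) → List (Subset n)
  tailsContaining0 E = map tail (filter (T? ∘ head) E)

  subsetCount-pascal : ∀ {n} r (E : List (Subset (suc n))) →
    subsetCount (suc r) E ≡ subsetCount r (tailsContaining0 E) + subsetCount (suc r) (tails E)
  subsetCount-pascal r [] = refl
  subsetCount-pascal r ((outside ∷ A) ∷ E) =
    trans (cong (∣ A ∣ C suc r +_) (subsetCount-pascal r E))
          (x∙yz≈y∙xz (∣ A ∣ C suc r) (subsetCount r (tailsContaining0 E)) _)
  subsetCount-pascal r ((inside ∷ A) ∷ E) = begin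
    suc ∣ A ∣ C suc r + subsetCount (suc r) E
      ≡⟨ cong₂ _+_ (sym (nCk+nC[k+1]≡[n+1]C[k+1] ∣ A ∣ r)) (subsetCount-pascal r E) ⟩
    (∣ A ∣ C r + ∣ A ∣ C suc r) + (subsetCount r (tailsContaining0 E) + subsetCount (suc r) (tails E))
      ≡⟨ interchange (∣ A ∣ C r) _ _ _ ⟩
    (∣ A ∣ C r + subsetCount r (tailsContaining0 E)) + (∣ A ∣ C suc r + subsetCount (suc r) (tails E)) ∎
    where open ≡-Reasoning

  tails-cover : ∀ {n} r {E : List (Subset (suc n))} → IsRCover r E → IsRCover r (tails E)
  tails-cover r cover B ∣B∣≡r with cover (outside ∷ B) ∣B∣≡r
  ... | _ ∷ A , A∈E , B⊆A = A , ∈-map⁺ tail A∈E , drop-∷-⊆ B⊆A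

  tailsContaining0-cover : ∀ {n} r {E : List (Subset (suc n))} →
    IsRCover (suc r) E → IsRCover r (tailsContaining0 E)
  tailsContaining0-cover r cover B ∣B∣≡r with cover (inside ∷ B) (cong suc ∣B∣≡r)
  ... | A , A∈E , B⊆A with B⊆A here
  ... | here = tail A , ∈-map⁺ tail (∈-filter⁺ (T? ∘ head) A∈E _) , drop-∷-⊆ B⊆A

  cover⇒C≤subsetCount : ∀ {n} r {E : List (Subset n)} → IsRCover r E → n C r ≤ subsetCount r E
  cover⇒C≤subsetCount {n} zero cover with cover ⊥ (∣⊥∣≡0 n)
  ... | _ , A∈E , _ = ∈⇒≤sum (λ A → ∣ A ∣ C 0) A∈E
  cover⇒C≤subsetCount {zero} (suc r) cover = z≤n
  cover⇒C≤subsetCount {suc n} (suc r) {E} cover = begin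
    suc n C suc r
      ≡⟨ nCk+nC[k+1]≡[n+1]C[k+1] n r ⟨
    n C r + n C suc r
      ≤⟨ +-mono-≤ (cover⇒C≤subsetCount r (tailsContaining0-cover r cover))
                  (cover⇒C≤subsetCount (suc r) (tails-cover (suc r) cover)) ⟩
    subsetCount r (tailsContaining0 E) + subsetCount (suc r) (tails E)
      ≡⟨ subsetCount-pascal r E ⟨
    subsetCount (suc r) E ∎
    where open ≤-Reasoning

  minimal⇒r≤∣member∣ : ∀ {n r} {E : List (Subset n)} → IsMinimalRCover r E → ∀ {A} → A ∈ E → r ≤ ∣ A ∣
  minimal⇒r≤∣member∣ {r = r} {E} (cover , minimal) {A} A∈E with r ≤? ∣ A ∣
  ... | yes r≤∣A∣ = r≤∣A∣
  ... | no r≰∣A∣ = contradiction large-cover (minimal large large⊆E (A , A∈E , A∉large))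
    where
    large? = λ X → r ≤? ∣ X ∣
    large = filter large? E
    large⊆E : ∀ {X} → X ∈ large → X ∈ E
    large⊆E = proj₁ ∘ ∈-filter⁻ large? {xs = E}
    A∉large : A ∉ large
    A∉large = r≰∣A∣ ∘ proj₂ ∘ ∈-filter⁻ large? {xs = E}
    large-cover : IsRCover r large
    large-cover B ∣B∣≡r with cover B ∣B∣≡r
    ... | X , X∈E , B⊆X = X , ∈-filter⁺ large? X∈E (subst (_≤ ∣ X ∣) ∣B∣≡r (p⊆q⇒∣p∣≤∣q∣ B⊆X)) , B⊆X

  module _ (f δ : ℕ → ℕ) (f-suc : ∀ x → f (suc x) ≡ δ x + f x) (δ-mono : ∀ {x y} → x ≤ y → δ x ≤ δ y) where

    increments-bound : ∀ {a b} → a ≤ b → f a ≤ a * δ b + f 0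
    increments-bound {zero} _ = ≤-refl
    increments-bound {suc a} {b} a<b = begin
      f (suc a)             ≡⟨ f-suc a ⟩
      δ a + f a             ≤⟨ +-mono-≤ (δ-mono (<⇒≤ a<b)) (increments-bound (<⇒≤ a<b)) ⟩
      δ b + (a * δ b + f 0) ≡⟨ +-assoc (δ b) (a * δ b) (f 0) ⟨
      suc a * δ b + f 0     ∎
      where open ≤-Reasoning

    chord-slope-mono : ∀ {a b} → a ≤ b → b * f a + a * f 0 ≤ a * f b + b * f 0
    chord-slope-mono {a} a≤b = go (≤⇒≤′ a≤b)
      where
      regroup : ∀ x y z u w → (x * y + z) + (x * u + w) ≡ x * (y + u) + (z + w)
      regroup = solve-∀
      go : ∀ {b} → a ≤′ b → b * f a + a * f 0 ≤ a * f b + b * f 0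
      go ≤′-refl = ≤-refl
      go (≤′-step {b} a≤′b) = begin
        suc b * f a + a * f 0                 ≡⟨ +-assoc (f a) (b * f a) (a * f 0) ⟩
        f a + (b * f a + a * f 0)             ≤⟨ +-mono-≤ (increments-bound (≤′⇒≤ a≤′b)) (go a≤′b) ⟩
        (a * δ b + f 0) + (a * f b + b * f 0) ≡⟨ regroup a (δ b) (f 0) (f b) (b * f 0) ⟩
        a * (δ b + f b) + suc b * f 0         ≡⟨ cong (λ z → a * z + suc b * f 0) (f-suc b) ⟨
        a * f (suc b) + suc b * f 0           ∎
        where open ≤-Reasoning

  C-monoˡ-≤ : ∀ k {m n} → m ≤ n → m C k ≤ n C k
  C-monoˡ-≤ k m≤n = go (≤⇒≤′ m≤n)
    where
    step : ∀ n k → n C k ≤ suc n C k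
    step n zero = ≤-refl
    step n (suc k) = subst (n C suc k ≤_) (nCk+nC[k+1]≡[n+1]C[k+1] n k) (m≤n+m (n C suc k) (n C k))
    go : ∀ {m n} → m ≤′ n → m C k ≤ n C k
    go ≤′-refl = ≤-refl
    go (≤′-step {n} m≤′n) = ≤-trans (go m≤′n) (step n k)

  1≤nCk : ∀ {n k} → k ≤ n → 1 ≤ n C k
  1≤nCk {n} {k} k≤n = subst (_≤ n C k) (nCn≡1 k) (C-monoˡ-≤ k k≤n)

  2≤nCk : ∀ {n k} → 0 < k → k < n → 2 ≤ n C k
  2≤nCk {suc n} {suc k} _ (s≤s k<n) =
    subst (2 ≤_) (nCk+nC[k+1]≡[n+1]C[k+1] n k) (+-mono-≤ (1≤nCk (<⇒≤ k<n)) (1≤nCk k<n))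

  binomial-chord : ∀ k {a b} → a ≤ b → b * ((a + k) C k) + a ≤ a * ((b + k) C k) + b
  binomial-chord zero {a} {b} _ =
    subst₂ _≤_ (cong (_+ a) (sym (*-identityʳ b))) (cong (_+ b) (sym (*-identityʳ a))) (≤-reflexive (+-comm b a))
  binomial-chord (suc k) {a} {b} a≤b = begin
    b * f a + a        ≡⟨ cong (b * f a +_) n*f0≡n ⟨
    b * f a + a * f 0  ≤⟨ chord-slope-mono f δ f-suc δ-mono a≤b ⟩
    a * f b + b * f 0  ≡⟨ cong (a * f b +_) n*f0≡n ⟩
    a * f b + b        ∎
    where
    open ≤-Reasoning
    f δ : ℕ → ℕ
    f x = (x + suc k) C suc k
    δ x = (x + suc k) C k
    f-suc : ∀ x → f (suc x) ≡ δ x + f x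
    f-suc x = sym (nCk+nC[k+1]≡[n+1]C[k+1] (x + suc k) k)
    δ-mono : ∀ {x y} → x ≤ y → δ x ≤ δ y
    δ-mono x≤y = C-monoˡ-≤ k (+-monoˡ-≤ (suc k) x≤y)
    n*f0≡n : ∀ {n} → n * f 0 ≡ n
    n*f0≡n {n} = trans (cong (n *_) (nCn≡1 (suc k))) (*-identityʳ n)

  -- (C(α + r, r) - 1) d ≤ α c with the subtractions moved across, for α = |A| - r and d = t - r.
  binomial-member-bound′ : ∀ {r α d c} → α ≤ d → (d + r) C r ≡ suc c →
    ((α + r) C r) * d + r * c ≤ (α + r) * c + d
  binomial-member-bound′ {r} {α} {d} {c} α≤d dCr = begin
    X * d + r * c         ≤⟨ +-monoˡ-≤ (r * c) (+-cancelˡ-≤ α (X * d) (α * c + d) chord) ⟩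
    (α * c + d) + r * c   ≡⟨ regroup α c d r ⟩
    (α + r) * c + d       ∎
    where
    open ≤-Reasoning
    X = (α + r) C r
    regroup : ∀ α c d r → (α * c + d) + r * c ≡ (α + r) * c + d
    regroup = solve-∀
    chord : α + X * d ≤ α + (α * c + d)
    chord = begin
      α + X * d               ≡⟨ trans (+-comm α (X * d)) (cong (_+ α) (*-comm X d)) ⟩
      d * X + α               ≤⟨ binomial-chord r α≤d ⟩
      α * ((d + r) C r) + d   ≡⟨ cong (λ z → α * z + d) dCr ⟩
      α * suc c + d           ≡⟨ trans (cong (_+ d) (*-suc α c)) (+-assoc α (α * c) d) ⟩
      α + (α * c + d)         ∎

  binomial-member-bound : ∀ {r a t c} → r ≤ a → a ≤ t → t C r ≡ suc c →
    (a C r) * (t ∸ r) + r * c ≤ a * c + (t ∸ r)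
  binomial-member-bound {r} {a} {t} {c} r≤a a≤t tCr =
    subst (λ x → (x C r) * (t ∸ r) + r * c ≤ x * c + (t ∸ r)) (m∸n+n≡m r≤a)
      (binomial-member-bound′ (∸-monoˡ-≤ r a≤t) (trans (cong (_C r) (m∸n+n≡m (≤-trans r≤a a≤t))) tCr))

  minimal-cover-bound : ∀ {t r c} {E : List (Subset t)} → IsMinimalRCover r E → t C r ≡ suc c →
    suc c * (t ∸ r) + length E * (r * c) ≤ sizeSum E * c + length E * (t ∸ r)
  minimal-cover-bound {t} {r} {c} {E} minimal tCr = begin
    suc c * d + k * (r * c)                       ≡⟨ cong (λ N → N * d + k * (r * c)) tCr ⟨
    (t C r) * d + k * (r * c)                     ≤⟨ +-monoˡ-≤ (k * (r * c)) (*-monoˡ-≤ d tCr≤count) ⟩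
    subsetCount r E * d + k * (r * c)             ≡⟨ sum-map-affine (λ A → ∣ A ∣ C r) d (r * c) E ⟨
    sum (map (λ A → (∣ A ∣ C r) * d + r * c) E)   ≤⟨ sum-map-mono E member-bound ⟩
    sum (map (λ A → ∣ A ∣ * c + d) E)             ≡⟨ sum-map-affine ∣_∣ c d E ⟩
    sizeSum E * c + k * d                         ∎
    where
    open ≤-Reasoning
    d = t ∸ r
    k = length E
    tCr≤count : t C r ≤ subsetCount r E
    tCr≤count = cover⇒C≤subsetCount r (proj₁ minimal)
    member-bound : ∀ {A} → A ∈ E → (∣ A ∣ C r) * d + r * c ≤ ∣ A ∣ * c + d
    member-bound {A} A∈E = binomial-member-bound (minimal⇒r≤∣member∣ minimal A∈E) (∣p∣≤n A) tCr

open import Data.Nat as ℕ using (ℕ; suc; _∸_; NonZero)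
import Data.Nat.Properties as ℕₚ
open import Data.Nat.Coprimality as Coprime using (1-coprimeTo)
open import Data.Integer as ℤ using (+_; +≤+)
import Data.Integer.Properties as ℤ
open import Data.Rational using (ℚ; mkℚ; toℚᵘ; _/_; _+_; _-_; _*_; -_; _≤_; 0ℚ; 1ℚ; 1/_; ≢-nonZero; Positive; *≤*)
open import Data.Rational.Properties
open import Data.Rational.Solver using (module +-*-Solver)
import Data.Rational.Unnormalised as ℚᵘ
import Data.Rational.Unnormalised.Properties as ℚᵘ

fromℕ : ℕ → ℚ
fromℕ n = + n / 1

fromℕ≡mkℚ : ∀ n → fromℕ n ≡ mkℚ (+ n) 0 (Coprime.sym (1-coprimeTo n))
fromℕ≡mkℚ n = normalize-coprime (Coprime.sym (1-coprimeTo n))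

fromℕ-+ : ∀ m n → fromℕ (m ℕ.+ n) ≡ fromℕ m + fromℕ n
fromℕ-+ m n = begin
  fromℕ (m ℕ.+ n)                   ≡⟨ cong₂ (λ x y → (x ℤ.+ y) / 1) (ℤ.*-identityʳ (+ m)) (ℤ.*-identityʳ (+ n)) ⟨
  (+ m ℤ.* + 1 ℤ.+ + n ℤ.* + 1) / 1 ≡⟨ cong₂ _+_ (fromℕ≡mkℚ m) (fromℕ≡mkℚ n) ⟨
  fromℕ m + fromℕ n                 ∎
  where open ≡-Reasoning

fromℕ-* : ∀ m n → fromℕ (m ℕ.* n) ≡ fromℕ m * fromℕ n
fromℕ-* m n = begin
  fromℕ (m ℕ.* n)      ≡⟨ cong (_/ 1) (ℤ.pos-* m n) ⟩
  (+ m ℤ.* + n) / 1    ≡⟨ cong₂ _*_ (fromℕ≡mkℚ m) (fromℕ≡mkℚ n) ⟨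
  fromℕ m * fromℕ n    ∎
  where open ≡-Reasoning

fromℕ-mono-≤ : ∀ {m n} → m ℕ.≤ n → fromℕ m ≤ fromℕ n
fromℕ-mono-≤ {m} {n} m≤n = subst₂ _≤_ (sym (fromℕ≡mkℚ m)) (sym (fromℕ≡mkℚ n))
  (*≤* (ℤ.*-monoʳ-≤-nonNeg (+ 1) (+≤+ m≤n)))

fromℕ-pos : ∀ n → .{{NonZero n}} → Positive (fromℕ n)
fromℕ-pos (suc n) = subst Positive (sym (fromℕ≡mkℚ (suc n))) _

/-*-cancel : ∀ m d → .{{_ : NonZero d}} → (+ m / d) * fromℕ d ≡ fromℕ m
/-*-cancel m (suc d) = toℚᵘ-injective (begin
  toℚᵘ ((+ m / suc d) * fromℕ (suc d))            ≈⟨ toℚᵘ-homo-* (+ m / suc d) (fromℕ (suc d)) ⟩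
  toℚᵘ (+ m / suc d) ℚᵘ.* toℚᵘ (fromℕ (suc d))  ≈⟨ ℚᵘ.*-cong (toℚᵘ-fromℚᵘ (ℚᵘ.mkℚᵘ (+ m) d)) (toℚᵘ-fromℚᵘ (ℚᵘ.mkℚᵘ (+ suc d) 0)) ⟩
  ℚᵘ.mkℚᵘ (+ m) d ℚᵘ.* ℚᵘ.mkℚᵘ (+ suc d) 0      ≈⟨ ℚᵘ.*≡* cross ⟩
  ℚᵘ.mkℚᵘ (+ m) 0                                ≈⟨ toℚᵘ-fromℚᵘ (ℚᵘ.mkℚᵘ (+ m) 0) ⟨
  toℚᵘ (fromℕ m)                                 ∎)
  where
  open ℚᵘ.≃-Reasoning
  cross : (+ m ℤ.* + suc d) ℤ.* + 1 ≡ + m ℤ.* + (suc d ℕ.* 1)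
  cross = trans (ℤ.*-identityʳ _) (cong (λ z → + m ℤ.* + z) (sym (ℕₚ.*-identityʳ (suc d))))

inv-/ᵗ-* : ∀ n d → .{{_ : NonZero n}} → .{{_ : NonZero d}} → inv ((+ n) /ᵗ d) * fromℕ n ≡ fromℕ d
inv-/ᵗ-* n (suc d) with + n / suc d ≟ 0ℚ
... | yes p≡0 = contradiction n≡0 (≢-sym (<⇒≢ (positive⁻¹ (fromℕ n) {{fromℕ-pos n}})))
  where
  open ≡-Reasoning
  n≡0 : fromℕ n ≡ 0ℚ
  n≡0 = begin
    fromℕ n                      ≡⟨ /-*-cancel n (suc d) ⟨
    (+ n / suc d) * fromℕ (suc d) ≡⟨ cong (_* fromℕ (suc d)) p≡0 ⟩
    0ℚ * fromℕ (suc d)           ≡⟨ *-zeroˡ (fromℕ (suc d)) ⟩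
    0ℚ                           ∎
... | no p≢0 = begin
  1/ p * fromℕ n             ≡⟨ cong (1/ p *_) (/-*-cancel n (suc d)) ⟨
  1/ p * (p * fromℕ (suc d)) ≡⟨ *-assoc (1/ p) p _ ⟨
  (1/ p * p) * fromℕ (suc d) ≡⟨ cong (_* fromℕ (suc d)) (*-inverseˡ p) ⟩
  1ℚ * fromℕ (suc d)         ≡⟨ *-identityˡ _ ⟩
  fromℕ (suc d)              ∎
  where
  open ≡-Reasoning
  p = + n / suc d
  instance _ = ≢-nonZero p≢0

mK≡[tCr∸1]/ᵗ[t∸r] : ∀ {t r} → 1 ℕ.≤ t C r → mK t r ≡ (+ (t C r ∸ 1)) /ᵗ (t ∸ r)
mK≡[tCr∸1]/ᵗ[t∸r] {t} {r} 1≤tCr = cong (_/ᵗ (t ∸ r)) (ℤ.⊖-≥ 1≤tCr)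

clear-denominator : ∀ {k r s t q d} c → .{{Positive c}} → q * c ≡ d → t ≡ r + d →
  (1ℚ + c) * d + k * (r * c) ≤ s * c + k * d → (k - 1ℚ) * (r - q) - s ≤ - t
clear-denominator {k} {r} {s} {q = q} c refl refl bound = *-cancelʳ-≤-pos c (begin
  ((k - 1ℚ) * (r - q) - s) * c  ≡⟨ expand k r s q c ⟩
  (- (r + q * c)) * c + (L - U) ≤⟨ +-monoʳ-≤ ((- (r + q * c)) * c) L-U≤0 ⟩
  (- (r + q * c)) * c + 0ℚ      ≡⟨ +-identityʳ _ ⟩
  (- (r + q * c)) * c           ∎)
  where
  open ≤-Reasoning
  open +-*-Solver
  L = (1ℚ + c) * (q * c) + k * (r * c)
  U = s * c + k * (q * c)
  expand : ∀ k r s q c → ((k - 1ℚ) * (r - q) - s) * c ≡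
    (- (r + q * c)) * c + (((1ℚ + c) * (q * c) + k * (r * c)) - (s * c + k * (q * c)))
  expand = solve 5 (λ k r s q c → ((k :- con 1ℚ) :* (r :- q) :- s) :* c :=
    (:- (r :+ q :* c)) :* c :+ (((con 1ℚ :+ c) :* (q :* c) :+ k :* (r :* c)) :- (s :* c :+ k :* (q :* c)))) refl
  L-U≤0 : L - U ≤ 0ℚ
  L-U≤0 = subst (L - U ≤_) (+-inverseʳ U) (+-monoˡ-≤ (- U) bound)

fromℕ-bound : ∀ k r s c d → suc c ℕ.* d ℕ.+ k ℕ.* (r ℕ.* c) ℕ.≤ s ℕ.* c ℕ.+ k ℕ.* d →
  (1ℚ + fromℕ c) * fromℕ d + fromℕ k * (fromℕ r * fromℕ c) ≤ fromℕ s * fromℕ c + fromℕ k * fromℕ d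
fromℕ-bound k r s c d bound = subst₂ _≤_
  (trans (fromℕ-+ (suc c ℕ.* d) (k ℕ.* (r ℕ.* c)))
         (cong₂ _+_ (trans (fromℕ-* (suc c) d) (cong (_* fromℕ d) (fromℕ-+ 1 c)))
                    (trans (fromℕ-* k (r ℕ.* c)) (cong (fromℕ k *_) (fromℕ-* r c)))))
  (trans (fromℕ-+ (s ℕ.* c) (k ℕ.* d)) (cong₂ _+_ (fromℕ-* s c) (fromℕ-* k d)))
  (fromℕ-mono-≤ bound)

lemma4p1 : (t r : ℕ) → 2 ℕ.≤ r → r ℕ.< t →
    (E : List (Subset t)) → Unique E →
    IsMinimalRCover r E → NonTrivial E →
    ((+ length E) / 1 - (+ 1) / 1) * ((+ r) / 1 - inv (mK t r)) - (+ sizeSum E) / 1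
      ≤ - ((+ t) / 1)
lemma4p1 t r 2≤r r<t E _ minimal _ =
  clear-denominator {fromℕ (length E)} {fromℕ r} {fromℕ (sizeSum E)} {fromℕ t} (fromℕ c) {{fromℕ-pos c}}
    inv-mK*c≡d t≡r+d (fromℕ-bound (length E) r (sizeSum E) c d (minimal-cover-bound minimal tCr≡1+c))
  where
  2≤tCr : 2 ℕ.≤ t C r
  2≤tCr = 2≤nCk (ℕₚ.<-≤-trans ℕₚ.0<1+n 2≤r) r<t
  c = t C r ∸ 1
  d = t ∸ r
  instance
    _ = ℕ.>-nonZero (ℕₚ.m<n⇒0<n∸m 2≤tCr)
    _ = ℕ.>-nonZero (ℕₚ.m<n⇒0<n∸m r<t)
  tCr≡1+c : t C r ≡ suc c
  tCr≡1+c = sym (ℕₚ.m+[n∸m]≡n (ℕₚ.<⇒≤ 2≤tCr))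
  inv-mK*c≡d : inv (mK t r) * fromℕ c ≡ fromℕ d
  inv-mK*c≡d = trans (cong (λ m → inv m * fromℕ c) (mK≡[tCr∸1]/ᵗ[t∸r] {t} {r} (ℕₚ.<⇒≤ 2≤tCr))) (inv-/ᵗ-* c d)
  t≡r+d : fromℕ t ≡ fromℕ r + fromℕ d
  t≡r+d = trans (cong fromℕ (sym (ℕₚ.m+[n∸m]≡n (ℕₚ.<⇒≤ r<t)))) (fromℕ-+ r d)
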